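{- For all $\psi_1,\psi_2\in\mathrm{MNF}$: if $\psi_1\equiv\psi_2$ in $\mathbf{TSC}$, then $\psi_1$ and $\psi_2$ are the same formula.
   Context: Ordinals range below $\varepsilon_0$. $\mathbb{F}_{\varepsilon_0}$ is the least set containing $\top$, closed under $\wedge$ and under unary modalities $\langle n^\alpha\rangle$ ($n<\omega$, $\alpha<\varepsilon_0$); $\langle n^0\rangle\varphi$ denotes $\varphi$. Hyper-exponentials: $e^0=\mathrm{id}$, $e^1(\alpha)=-1+\omega^\alpha$, $e^{n+m}=e^n\circ e^m$. MNF is the least set with: $\top\in$ MNF; each monomial $\langle n^\alpha\rangle\top\in$ MNF; if $\langle n_0^{\alpha_0}\rangle\top\wedge\cdots\wedge\langle n_k^{\alpha_k}\rangle\top\in$ MNF, $n<n_0$, and $\alpha=e^{n_0-n}(\alpha_0)\cdot(2+\beta)$ for some $\beta<\varepsilon_0$, then $\langle n^\alpha\rangle\top\wedge\langle n_0^{\alpha_0}\rangle\top\wedge\cdots\wedge\langle n_k^{\alpha_k}\rangle\top\in$ MNF. $\mathbf{TSC}$ derives sequents $\varphi\vdash\psi$; $\varphi\equiv\psi$ means both directions derivable. Axioms: $\varphi\vdash\varphi$; $\varphi\vdash\top$; $\varphi\wedge\psi\vdash\varphi$; $\varphi\wedge\psi\vdash\psi$; $\langle n^\alpha\rangle\varphi\vdash\langle n^\beta\rangle\varphi$ for $\beta\le\alpha$; $\langle n^{\alpha+\beta}\rangle\varphi\equiv\langle n^\beta\rangle\langle n^\alpha\rangle\varphi$; $\langle(m+n)^\alpha\rangle\varphi\vdash\langle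 m^{e^n(\alpha)}\rangle\varphi$; Schmerl axioms $\langle n^\alpha\rangle(\langle n_0^{\alpha_0}\rangle\top\wedge\cdots\wedge\langle n_k^{\alpha_k}\rangle\top)\equiv\langle n^{e^{n_0-n}(\alpha_0)\cdot(1+\alpha)}\rangle\top\wedge\langle n_0^{\alpha_0}\rangle\top\wedge\cdots\wedge\langle n_k^{\alpha_k}\rangle\top$ for $n<n_0$ and the conjunction in MNF. Rules: from $\varphi\vdash\psi$, $\varphi\vdash\chi$ infer $\varphi\vdash\psi\wedge\chi$; from $\varphi\vdash\psi$, $\psi\vdash\chi$ infer $\varphi\vdash\chi$; from $\varphi\vdash\psi$ infer $\langle n^\alpha\rangle\varphi\vdash\langle n^\alpha\rangle\psi$; from $\varphi\vdash\psi$ infer $\langle n^\alpha\rangle\varphi\wedge\langle m^{\beta+1}\rangle\psi\vdash\langle n^\alpha\rangle(\varphi\wedge\langle m^{\beta+1}\rangle\psi)$ for $m<n$. -}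

module Defs where

open import Data.Nat using (ℕ; zero; suc; _∸_) renaming (_<_ to _<ℕ_; _+_ to _+ℕ_)
open import Data.Product using (Σ; _×_; _,_; ∃)
open import Data.Sum using (_⊎_)
open import Relation.Binary.PropositionalEquality using (_≡_; _≢_)

-- An ordinal < ε₀ is a raw
-- term satisfying NF (exponents weakly decreasing); every ordinal < ε₀
-- has exactly one such representation, so ≡ on NF terms is ordinal
-- equality.

data Tm : Set where
  𝟎    : Tm
  ω^_+_ : Tm → Tm → Tm

data Cmp : Set where
  lt eq gt : Cmp

cmp : Tm → Tm → Cmp
cmp 𝟎 𝟎 = eq
cmp 𝟎 (ω^ _ + _) = lt
cmp (ω^ _ + _) 𝟎 = gt
cmp (ω^ a + b) (ω^ c + d) with cmp a c
... | lt = lt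
... | gt = gt
... | eq = cmp b d

-- strict and non-strict order (correct on NF terms)
_<_ : Tm → Tm → Set
α < β = cmp α β ≡ lt

_≤_ : Tm → Tm → Set
α ≤ β = α < β ⊎ α ≡ β

data NF : Tm → Set where
  nf𝟎 : NF 𝟎
  nf₁ : ∀ {a} → NF a → NF (ω^ a + 𝟎)
  nf₂ : ∀ {a c d} → NF a → NF (ω^ c + d) → c ≤ a → NF (ω^ a + (ω^ c + d))

infixl 6 _+_
_+_ : Tm → Tm → Tm
𝟎 + γ = γ
(ω^ a + b) + 𝟎 = ω^ a + b
(ω^ a + b) + (ω^ c + d) with cmp a c
... | lt = ω^ c + d
... | _  = ω^ a + (b + (ω^ c + d))

-- ordinal multiplication (left distributivity, α·ω^c = ω^(a+c) for c > 0)
infixl 7 _·_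
_·_ : Tm → Tm → Tm
α · 𝟎 = 𝟎
𝟎 · (ω^ _ + _) = 𝟎
(ω^ a + b) · (ω^ 𝟎 + d) = (ω^ a + b) + ((ω^ a + b) · d)
(ω^ a + b) · (ω^ (ω^ c₁ + c₂) + d) = (ω^ (a + (ω^ c₁ + c₂)) + 𝟎) + ((ω^ a + b) · d)

𝟏 𝟐 : Tm
𝟏 = ω^ 𝟎 + 𝟎
𝟐 = ω^ 𝟎 + 𝟏

-- e¹(α) = -1 + ω^α
e¹ : Tm → Tm
e¹ 𝟎 = 𝟎
e¹ (ω^ a + b) = ω^ (ω^ a + b) + 𝟎

e : ℕ → Tm → Tm
e zero α = α
e (suc n) α = e¹ (e n α)

-- Formulas.  The raw modality ⟨ n ^ α ⟩ is only used with α ≠ 0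
-- (enforced by WF); ⟪ n ^ α ⟫ φ is the notation of the paper, where
-- ⟨n^0⟩φ denotes φ.

infixr 5 _∧_
data Fm : Set where
  ⊤     : Fm
  _∧_   : Fm → Fm → Fm
  ⟨_^_⟩_ : ℕ → Tm → Fm → Fm

⟪_^_⟫_ : ℕ → Tm → Fm → Fm
⟪ n ^ 𝟎 ⟫ φ = φ
⟪ n ^ (ω^ a + b) ⟫ φ = ⟨ n ^ (ω^ a + b) ⟩ φ

data WF : Fm → Set where
  wf⊤ : WF ⊤
  wf∧ : ∀ {φ ψ} → WF φ → WF ψ → WF (φ ∧ ψ)
  wf⟨⟩ : ∀ {n α φ} → NF α → α ≢ 𝟎 → WF φ → WF (⟨ n ^ α ⟩ φ)

-- Modal normal forms.  Conjunctions are right-nested.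
-- Chain n₀ α₀ φ : φ is a MNF conjunction of monomials whose first
-- monomial is ⟨n₀^α₀⟩⊤ (with α₀ > 0).

data Chain : ℕ → Tm → Fm → Set where
  mono : ∀ {n α} → NF α → α ≢ 𝟎 → Chain n α (⟨ n ^ α ⟩ ⊤)
  cons : ∀ {n α n₀ α₀ φ} (β : Tm) → Chain n₀ α₀ φ → n <ℕ n₀ → NF β →
         α ≡ e (n₀ ∸ n) α₀ · (𝟐 + β) →
         Chain n α (⟨ n ^ α ⟩ ⊤ ∧ φ)

MNF : Fm → Set
MNF φ = φ ≡ ⊤ ⊎ Σ ℕ λ n → Σ Tm λ α → Chain n α φ

infix 3 _⊢_
data _⊢_ : Fm → Fm → Set where
  ax-id  : ∀ {φ} → WF φ → φ ⊢ φ
  ax-⊤   : ∀ {φ} → WF φ → φ ⊢ ⊤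
  ax-∧ˡ  : ∀ {φ ψ} → WF φ → WF ψ → φ ∧ ψ ⊢ φ
  ax-∧ʳ  : ∀ {φ ψ} → WF φ → WF ψ → φ ∧ ψ ⊢ ψ
  ax-mono : ∀ {n α β φ} → NF α → NF β → β ≤ α → WF φ →
            ⟪ n ^ α ⟫ φ ⊢ ⟪ n ^ β ⟫ φ
  ax-add₁ : ∀ {n α β φ} → NF α → NF β → WF φ →
            ⟪ n ^ (α + β) ⟫ φ ⊢ ⟪ n ^ β ⟫ ⟪ n ^ α ⟫ φ
  ax-add₂ : ∀ {n α β φ} → NF α → NF β → WF φ →
            ⟪ n ^ β ⟫ ⟪ n ^ α ⟫ φ ⊢ ⟪ n ^ (α + β) ⟫ φ
  ax-red  : ∀ {m n α φ} → NF α → WF φ →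
            ⟪ (m +ℕ n) ^ α ⟫ φ ⊢ ⟪ m ^ e n α ⟫ φ
  ax-sch₁ : ∀ {n n₀ α α₀ ψ} → n <ℕ n₀ → Chain n₀ α₀ ψ → NF α →
            ⟪ n ^ α ⟫ ψ ⊢ ⟪ n ^ (e (n₀ ∸ n) α₀ · (𝟏 + α)) ⟫ ⊤ ∧ ψ
  ax-sch₂ : ∀ {n n₀ α α₀ ψ} → n <ℕ n₀ → Chain n₀ α₀ ψ → NF α →
            ⟪ n ^ (e (n₀ ∸ n) α₀ · (𝟏 + α)) ⟫ ⊤ ∧ ψ ⊢ ⟪ n ^ α ⟫ ψ
  r-∧    : ∀ {φ ψ χ} → φ ⊢ ψ → φ ⊢ χ → φ ⊢ ψ ∧ χ
  r-cut  : ∀ {φ ψ χ} → φ ⊢ ψ → ψ ⊢ χ → φ ⊢ χ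
  r-nec  : ∀ {n α φ ψ} → NF α → φ ⊢ ψ → ⟪ n ^ α ⟫ φ ⊢ ⟪ n ^ α ⟫ ψ
  r-last : ∀ {n m α β φ ψ} → NF α → NF β → m <ℕ n → φ ⊢ ψ →
           ⟪ n ^ α ⟫ φ ∧ ⟪ m ^ (β + 𝟏) ⟫ ψ ⊢ ⟪ n ^ α ⟫ (φ ∧ ⟪ m ^ (β + 𝟏) ⟫ ψ)

_≣_ : Fm → Fm → Set
φ ≣ ψ = (φ ⊢ ψ) × (ψ ⊢ φ)

-- Formulas are read on points: sequences p of ordinals in which each p j is a multiple of
-- ω^(p (j+1)).  ⟨n^α⟩φ holds at p when φ holds at some point q with T n α q ≼ p pointwise,
-- where T n α q adds ω^(q (n+1))·α at coordinate n and then, going down, ω^(new value of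
-- coordinate j+1) at each coordinate j < n.  TSC is sound for this upward-closed semantics.
-- A modal normal form ψ other than ⊤ has a least point ⌊ψ⌋, built monomial by monomial:
-- Schmerl's axiom is exactly what makes T n (𝟏 + β) ⌊ψ⌋ the least point of ⟨n^α⟩⊤ ∧ ψ.
-- Hence equivalent normal forms have the same least point, and the least point determines the
-- normal form: its first modality sits at the least n with ⌊ψ⌋ n ≠ e¹ (⌊ψ⌋ (n+1)), its
-- exponent is ⌊ψ⌋ n, and the rest of the chain is recovered from the coordinates above n.
-- Finally ⊤ is the only normal form that holds at the zero point.
module Submission where

open import Defs
open import Data.Empty using (⊥; ⊥-elim)
open import Data.Nat using (ℕ; zero; suc; z≤n; s≤s; _∸_) renaming (_<_ to _<ℕ_; _≤_ to _≤ℕ_; _+_ to _+ℕ_)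
import Data.Nat.Properties as ℕ
open import Data.Product using (Σ; _×_; _,_; proj₁)
open import Data.Sum using (_⊎_; inj₁; inj₂)
open import Data.Unit using (tt) renaming (⊤ to Unit)
open import Relation.Binary.Definitions using (tri<; tri≈; tri>)
open import Relation.Binary.PropositionalEquality using (_≡_; _≢_; _≗_; refl; sym; trans; cong; cong₂; subst)

-- A structural order on terms; on NF terms it agrees with the cmp-based _<_ of Defs (<⇒≺, ≼⇒≤).
infix 4 _≺_ _≼_

data _≺_ : Tm → Tm → Set where
  𝟎≺ω^   : ∀ {a b} → 𝟎 ≺ ω^ a + b
  ≺-head : ∀ {a b c d} → a ≺ c → ω^ a + b ≺ ω^ c + d
  ≺-tail : ∀ {a b d} → b ≺ d → ω^ a + b ≺ ω^ a + d

_≼_ : Tm → Tm → Set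
a ≼ b = a ≺ b ⊎ a ≡ b

≺-irrefl : ∀ {a} → a ≺ a → ⊥
≺-irrefl (≺-head p) = ≺-irrefl p
≺-irrefl (≺-tail p) = ≺-irrefl p

≺-trans : ∀ {a b c} → a ≺ b → b ≺ c → a ≺ c
≺-trans 𝟎≺ω^ (≺-head q) = 𝟎≺ω^
≺-trans 𝟎≺ω^ (≺-tail q) = 𝟎≺ω^
≺-trans (≺-head p) (≺-head q) = ≺-head (≺-trans p q)
≺-trans (≺-head p) (≺-tail q) = ≺-head p
≺-trans (≺-tail p) (≺-head q) = ≺-head q
≺-trans (≺-tail p) (≺-tail q) = ≺-tail (≺-trans p q)

≼-trans : ∀ {a b c} → a ≼ b → b ≼ c → a ≼ c
≼-trans (inj₁ p) (inj₁ q) = inj₁ (≺-trans p q)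
≼-trans (inj₁ p) (inj₂ refl) = inj₁ p
≼-trans (inj₂ refl) q = q

≺-≼-trans : ∀ {a b c} → a ≺ b → b ≼ c → a ≺ c
≺-≼-trans p (inj₁ q) = ≺-trans p q
≺-≼-trans p (inj₂ refl) = p

≼-≺-trans : ∀ {a b c} → a ≼ b → b ≺ c → a ≺ c
≼-≺-trans (inj₁ p) q = ≺-trans p q
≼-≺-trans (inj₂ refl) q = q

≼-antisym : ∀ {a b} → a ≼ b → b ≼ a → a ≡ b
≼-antisym (inj₂ a≡b) _ = a≡b
≼-antisym (inj₁ p) (inj₂ b≡a) = sym b≡a
≼-antisym (inj₁ p) (inj₁ q) = ⊥-elim (≺-irrefl (≺-trans p q))

𝟎≼ : ∀ {a} → 𝟎 ≼ a
𝟎≼ {𝟎} = inj₂ refl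
𝟎≼ {ω^ a + b} = inj₁ 𝟎≺ω^

≼𝟎⇒≡𝟎 : ∀ {a} → a ≼ 𝟎 → a ≡ 𝟎
≼𝟎⇒≡𝟎 (inj₂ a≡𝟎) = a≡𝟎

≼-tail : ∀ {a b d} → b ≼ d → ω^ a + b ≼ ω^ a + d
≼-tail (inj₁ p) = inj₁ (≺-tail p)
≼-tail (inj₂ refl) = inj₂ refl

≺-or-≽ : ∀ a b → a ≺ b ⊎ b ≼ a
≺-or-≽ 𝟎 𝟎 = inj₂ (inj₂ refl)
≺-or-≽ 𝟎 (ω^ _ + _) = inj₁ 𝟎≺ω^
≺-or-≽ (ω^ _ + _) 𝟎 = inj₂ (inj₁ 𝟎≺ω^)
≺-or-≽ (ω^ a + b) (ω^ c + d) with ≺-or-≽ a c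
... | inj₁ p = inj₁ (≺-head p)
... | inj₂ (inj₁ p) = inj₂ (inj₁ (≺-head p))
... | inj₂ (inj₂ refl) with ≺-or-≽ b d
...   | inj₁ q = inj₁ (≺-tail q)
...   | inj₂ q = inj₂ (≼-tail q)

cmp-refl : ∀ a → cmp a a ≡ eq
cmp-refl 𝟎 = refl
cmp-refl (ω^ a + b) rewrite cmp-refl a = cmp-refl b

≺⇒cmp≡lt : ∀ {a b} → a ≺ b → cmp a b ≡ lt
≺⇒cmp≡lt 𝟎≺ω^ = refl
≺⇒cmp≡lt (≺-head p) rewrite ≺⇒cmp≡lt p = refl
≺⇒cmp≡lt (≺-tail {a} p) rewrite cmp-refl a = ≺⇒cmp≡lt p

≻⇒cmp≡gt : ∀ {a b} → b ≺ a → cmp a b ≡ gt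
≻⇒cmp≡gt 𝟎≺ω^ = refl
≻⇒cmp≡gt (≺-head p) rewrite ≻⇒cmp≡gt p = refl
≻⇒cmp≡gt (≺-tail {a} p) rewrite cmp-refl a = ≻⇒cmp≡gt p

<⇒≺ : ∀ {a b} → a < b → a ≺ b
<⇒≺ {a} {b} a<b with ≺-or-≽ a b
... | inj₁ p = p
... | inj₂ (inj₁ p) with () ← trans (sym (≻⇒cmp≡gt p)) a<b
... | inj₂ (inj₂ refl) with () ← trans (sym (cmp-refl a)) a<b

≼⇒≤ : ∀ {a b} → a ≼ b → a ≤ b
≼⇒≤ (inj₁ p) = inj₁ (≺⇒cmp≡lt p)
≼⇒≤ (inj₂ a≡b) = inj₂ a≡b

≤⇒≼ : ∀ {a b} → a ≤ b → a ≼ b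
≤⇒≼ (inj₁ p) = inj₁ (<⇒≺ p)
≤⇒≼ (inj₂ a≡b) = inj₂ a≡b

+-identityʳ : ∀ a → a + 𝟎 ≡ a
+-identityʳ 𝟎 = refl
+-identityʳ (ω^ a + b) = refl

+-absorb : ∀ {a b c d} → a ≺ c → (ω^ a + b) + (ω^ c + d) ≡ ω^ c + d
+-absorb p rewrite ≺⇒cmp≡lt p = refl

+-cons : ∀ {a b c d} → c ≼ a → (ω^ a + b) + (ω^ c + d) ≡ ω^ a + (b + (ω^ c + d))
+-cons (inj₁ p) rewrite ≻⇒cmp≡gt p = refl
+-cons {a} (inj₂ refl) rewrite cmp-refl a = refl

data Lead≼ (a : Tm) : Tm → Set where
  lead-𝟎  : Lead≼ a 𝟎
  lead-ω^ : ∀ {c d} → c ≼ a → Lead≼ a (ω^ c + d)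

+-cons′ : ∀ {a b} X → Lead≼ a X → (ω^ a + b) + X ≡ ω^ a + (b + X)
+-cons′ {a} {b} 𝟎 lead-𝟎 = cong (ω^ a +_) (sym (+-identityʳ b))
+-cons′ (ω^ c + d) (lead-ω^ p) = +-cons p

Lead≼-+ : ∀ {a} B C → Lead≼ a B → Lead≼ a C → Lead≼ a (B + C)
Lead≼-+ 𝟎 C lb lc = lc
Lead≼-+ (ω^ g + h) 𝟎 lb lc = lb
Lead≼-+ (ω^ g + h) (ω^ u + v) (lead-ω^ g≼a) lc with ≺-or-≽ g u
... | inj₁ g≺u rewrite +-absorb {g} {h} {u} {v} g≺u = lc
... | inj₂ u≼g rewrite +-cons {g} {h} {u} {v} u≼g = lead-ω^ g≼a

+-assoc : ∀ a b c → (a + b) + c ≡ a + (b + c)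
+-assoc 𝟎 b c = refl
+-assoc (ω^ x + y) 𝟎 c = refl
+-assoc (ω^ x + y) (ω^ g + h) 𝟎 = +-identityʳ ((ω^ x + y) + (ω^ g + h))
+-assoc (ω^ x + y) (ω^ g + h) (ω^ u + v) with ≺-or-≽ x g | ≺-or-≽ g u
... | inj₁ x≺g | inj₁ g≺u
  rewrite +-absorb {x} {y} {g} {h} x≺g | +-absorb {g} {h} {u} {v} g≺u
        | +-absorb {x} {y} {u} {v} (≺-trans x≺g g≺u) = refl
... | inj₁ x≺g | inj₂ u≼g
  rewrite +-absorb {x} {y} {g} {h} x≺g | +-cons {g} {h} {u} {v} u≼g
        | +-absorb {x} {y} {g} {h + (ω^ u + v)} x≺g = refl
... | inj₂ g≼x | _ rewrite +-cons {x} {y} {g} {h} g≼x with ≺-or-≽ x u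
...   | inj₁ x≺u
  rewrite +-absorb {x} {y + (ω^ g + h)} {u} {v} x≺u | +-absorb {g} {h} {u} {v} (≼-≺-trans g≼x x≺u)
        | +-absorb {x} {y} {u} {v} x≺u = refl
...   | inj₂ u≼x
  rewrite +-cons {x} {y + (ω^ g + h)} {u} {v} u≼x | +-assoc y (ω^ g + h) (ω^ u + v) =
  sym (+-cons′ ((ω^ g + h) + (ω^ u + v)) (Lead≼-+ (ω^ g + h) (ω^ u + v) (lead-ω^ g≼x) (lead-ω^ u≼x)))

+-≢𝟎ˡ : ∀ {a b} y → (ω^ a + b) + y ≢ 𝟎
+-≢𝟎ˡ 𝟎 ()
+-≢𝟎ˡ {a} {b} (ω^ c + d) with ≺-or-≽ a c
... | inj₁ a≺c rewrite +-absorb {a} {b} {c} {d} a≺c = λ ()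
... | inj₂ c≼a rewrite +-cons {a} {b} {c} {d} c≼a = λ ()

+-≢𝟎ʳ : ∀ x {c d} → x + (ω^ c + d) ≢ 𝟎
+-≢𝟎ʳ 𝟎 ()
+-≢𝟎ʳ (ω^ a + b) = +-≢𝟎ˡ (ω^ _ + _)

NF-head : ∀ {a b} → NF (ω^ a + b) → NF a
NF-head (nf₁ p) = p
NF-head (nf₂ p _ _) = p

NF-tail : ∀ {a b} → NF (ω^ a + b) → NF b
NF-tail (nf₁ _) = nf𝟎
NF-tail (nf₂ _ q _) = q

NF-lead : ∀ {a b} → NF (ω^ a + b) → Lead≼ a b
NF-lead (nf₁ _) = lead-𝟎
NF-lead (nf₂ _ _ r) = lead-ω^ (≤⇒≼ r)

NF-ω^ : ∀ {a b} → NF a → NF b → Lead≼ a b → NF (ω^ a + b)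
NF-ω^ na nf𝟎 lead-𝟎 = nf₁ na
NF-ω^ na nb (lead-ω^ p) = nf₂ na nb (≼⇒≤ p)

NF-+ : ∀ {a b} → NF a → NF b → NF (a + b)
NF-+ {𝟎} na nb = nb
NF-+ {ω^ x + y} {𝟎} na nb = na
NF-+ {ω^ x + y} {ω^ g + h} na nb with ≺-or-≽ x g
... | inj₁ x≺g rewrite +-absorb {x} {y} {g} {h} x≺g = nb
... | inj₂ g≼x rewrite +-cons {x} {y} {g} {h} g≼x =
  NF-ω^ (NF-head na) (NF-+ (NF-tail na) nb) (Lead≼-+ y (ω^ g + h) (NF-lead na) (lead-ω^ g≼x))

NF-𝟏 : NF 𝟏
NF-𝟏 = nf₁ nf𝟎

lead-≼ : ∀ {a b c d} → ω^ a + b ≺ ω^ c + d → a ≼ c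
lead-≼ (≺-head p) = inj₁ p
lead-≼ (≺-tail p) = inj₂ refl

+-monoʳ-≺ : ∀ a {b c} → b ≺ c → a + b ≺ a + c
+-monoʳ-≺ 𝟎 p = p
+-monoʳ-≺ (ω^ x + y) {𝟎} {ω^ g + h} 𝟎≺ω^ with ≺-or-≽ x g
... | inj₁ x≺g rewrite +-absorb {x} {y} {g} {h} x≺g = ≺-head x≺g
... | inj₂ g≼x rewrite +-cons {x} {y} {g} {h} g≼x =
  ≺-tail (subst (_≺ y + (ω^ g + h)) (+-identityʳ y) (+-monoʳ-≺ y 𝟎≺ω^))
+-monoʳ-≺ (ω^ x + y) {ω^ e + f} {ω^ g + h} b≺c with ≺-or-≽ x e | ≺-or-≽ x g
... | inj₁ x≺e | _
  rewrite +-absorb {x} {y} {e} {f} x≺e | +-absorb {x} {y} {g} {h} (≺-≼-trans x≺e (lead-≼ b≺c)) = b≺c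
... | inj₂ e≼x | inj₁ x≺g
  rewrite +-cons {x} {y} {e} {f} e≼x | +-absorb {x} {y} {g} {h} x≺g = ≺-head x≺g
... | inj₂ e≼x | inj₂ g≼x
  rewrite +-cons {x} {y} {e} {f} e≼x | +-cons {x} {y} {g} {h} g≼x = ≺-tail (+-monoʳ-≺ y b≺c)

+-monoʳ-≼ : ∀ a {b c} → b ≼ c → a + b ≼ a + c
+-monoʳ-≼ a (inj₁ p) = inj₁ (+-monoʳ-≺ a p)
+-monoʳ-≼ a (inj₂ refl) = inj₂ refl

a≼a+b : ∀ a b → a ≼ a + b
a≼a+b a b = subst (_≼ a + b) (+-identityʳ a) (+-monoʳ-≼ a 𝟎≼)

a≺a+ω^ : ∀ a {c d} → a ≺ a + (ω^ c + d)
a≺a+ω^ a = subst (_≺ a + _) (+-identityʳ a) (+-monoʳ-≺ a 𝟎≺ω^)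

tail≺ : ∀ {a b} → NF (ω^ a + b) → b ≺ ω^ a + b
tail≺ (nf₁ _) = 𝟎≺ω^
tail≺ (nf₂ _ nb r) with ≤⇒≼ r
... | inj₁ p = ≺-head p
... | inj₂ refl = ≺-tail (tail≺ nb)

b≼a+b : ∀ a b → NF b → b ≼ a + b
b≼a+b 𝟎 b nb = inj₂ refl
b≼a+b (ω^ x + y) 𝟎 nb = 𝟎≼
b≼a+b (ω^ x + y) (ω^ g + h) nb with ≺-or-≽ x g
... | inj₁ x≺g rewrite +-absorb {x} {y} {g} {h} x≺g = inj₂ refl
... | inj₂ (inj₁ g≺x) rewrite +-cons {x} {y} {g} {h} (inj₁ g≺x) = inj₁ (≺-head g≺x)
... | inj₂ (inj₂ refl) rewrite +-cons {x} {y} {x} {h} (inj₂ refl) =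
  inj₁ (≺-tail (≺-≼-trans (tail≺ nb) (b≼a+b y (ω^ x + h) nb)))

+-monoˡ-≼ : ∀ {a b} c → NF c → a ≼ b → a + c ≼ b + c
+-monoˡ-≼ c nc (inj₂ refl) = inj₂ refl
+-monoˡ-≼ {a} {b} 𝟎 nc (inj₁ p) rewrite +-identityʳ a | +-identityʳ b = inj₁ p
+-monoˡ-≼ {𝟎} {b} (ω^ g + h) nc (inj₁ 𝟎≺ω^) = b≼a+b b (ω^ g + h) nc
+-monoˡ-≼ {ω^ x + y} {ω^ u + v} (ω^ g + h) nc (inj₁ a≺b) with ≺-or-≽ x g
... | inj₁ x≺g rewrite +-absorb {x} {y} {g} {h} x≺g = b≼a+b (ω^ u + v) (ω^ g + h) nc
... | inj₂ g≼x with a≺b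
...   | ≺-head x≺u
  rewrite +-cons {x} {y} {g} {h} g≼x | +-cons {u} {v} {g} {h} (inj₁ (≼-≺-trans g≼x x≺u)) = inj₁ (≺-head x≺u)
...   | ≺-tail y≺v
  rewrite +-cons {x} {y} {g} {h} g≼x | +-cons {x} {v} {g} {h} g≼x = ≼-tail (+-monoˡ-≼ (ω^ g + h) nc (inj₁ y≺v))

ω^⟨_⟩ : Tm → Tm
ω^⟨ a ⟩ = ω^ a + 𝟎

ω^⟨⟩-mono-≼ : ∀ {a b} → a ≼ b → ω^⟨ a ⟩ ≼ ω^⟨ b ⟩
ω^⟨⟩-mono-≼ (inj₁ p) = inj₁ (≺-head p)
ω^⟨⟩-mono-≼ (inj₂ refl) = inj₂ refl

infixr 7 ω^⟨_⟩·_
ω^⟨_⟩·_ : Tm → Tm → Tm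
ω^⟨ a ⟩· 𝟎 = 𝟎
ω^⟨ a ⟩· (ω^ c + d) = ω^ (a + c) + (ω^⟨ a ⟩· d)

ω^·-Lead≼ : ∀ a {c d} → Lead≼ c d → Lead≼ (a + c) (ω^⟨ a ⟩· d)
ω^·-Lead≼ a lead-𝟎 = lead-𝟎
ω^·-Lead≼ a (lead-ω^ p) = lead-ω^ (+-monoʳ-≼ a p)

NF-ω^· : ∀ {a β} → NF a → NF β → NF (ω^⟨ a ⟩· β)
NF-ω^· na nf𝟎 = nf𝟎
NF-ω^· {a} {ω^ c + d} na nβ = NF-ω^ (NF-+ na (NF-head nβ)) (NF-ω^· na (NF-tail nβ)) (ω^·-Lead≼ a (NF-lead nβ))

ω^·-≢𝟎 : ∀ a {β} → β ≢ 𝟎 → ω^⟨ a ⟩· β ≢ 𝟎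
ω^·-≢𝟎 a {𝟎} β≢𝟎 = ⊥-elim (β≢𝟎 refl)
ω^·-≢𝟎 a {ω^ c + d} _ ()

ω^·-distribʳ-+ : ∀ a β γ → ω^⟨ a ⟩· (β + γ) ≡ ω^⟨ a ⟩· β + ω^⟨ a ⟩· γ
ω^·-distribʳ-+ a 𝟎 γ = refl
ω^·-distribʳ-+ a (ω^ c + d) 𝟎 = sym (+-identityʳ _)
ω^·-distribʳ-+ a (ω^ c + d) (ω^ e + f) with ≺-or-≽ c e
... | inj₁ c≺e
  rewrite +-absorb {c} {d} {e} {f} c≺e
        | +-absorb {a + c} {ω^⟨ a ⟩· d} {a + e} {ω^⟨ a ⟩· f} (+-monoʳ-≺ a c≺e) = refl
... | inj₂ e≼c
  rewrite +-cons {c} {d} {e} {f} e≼c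
        | +-cons {a + c} {ω^⟨ a ⟩· d} {a + e} {ω^⟨ a ⟩· f} (+-monoʳ-≼ a e≼c) =
  cong (ω^ (a + c) +_) (ω^·-distribʳ-+ a d (ω^ e + f))

ω^·-monoʳ-≺ : ∀ a {β γ} → β ≺ γ → ω^⟨ a ⟩· β ≺ ω^⟨ a ⟩· γ
ω^·-monoʳ-≺ a 𝟎≺ω^ = 𝟎≺ω^
ω^·-monoʳ-≺ a (≺-head p) = ≺-head (+-monoʳ-≺ a p)
ω^·-monoʳ-≺ a (≺-tail p) = ≺-tail (ω^·-monoʳ-≺ a p)

ω^·-monoʳ-≼ : ∀ a {β γ} → β ≼ γ → ω^⟨ a ⟩· β ≼ ω^⟨ a ⟩· γ
ω^·-monoʳ-≼ a (inj₁ p) = inj₁ (ω^·-monoʳ-≺ a p)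
ω^·-monoʳ-≼ a (inj₂ refl) = inj₂ refl

ω^·-monoˡ-≼ : ∀ {a b} β → NF β → a ≼ b → ω^⟨ a ⟩· β ≼ ω^⟨ b ⟩· β
ω^·-monoˡ-≼ 𝟎 nβ p = inj₂ refl
ω^·-monoˡ-≼ (ω^ c + d) nβ p with +-monoˡ-≼ c (NF-head nβ) p
... | inj₁ q = inj₁ (≺-head q)
... | inj₂ q rewrite q = ≼-tail (ω^·-monoˡ-≼ d (NF-tail nβ) p)

ω^⟨𝟎⟩·-identity : ∀ β → ω^⟨ 𝟎 ⟩· β ≡ β
ω^⟨𝟎⟩·-identity 𝟎 = refl
ω^⟨𝟎⟩·-identity (ω^ c + d) = cong (ω^ c +_) (ω^⟨𝟎⟩·-identity d)

ω^·𝟏 : ∀ a → ω^⟨ a ⟩· 𝟏 ≡ ω^⟨ a ⟩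
ω^·𝟏 a = cong ω^⟨_⟩ (+-identityʳ a)

ω^·≡· : ∀ a β → NF β → ω^⟨ a ⟩ · β ≡ ω^⟨ a ⟩· β
ω^·≡· a 𝟎 nβ = refl
ω^·≡· a (ω^ 𝟎 + d) nβ rewrite ω^·≡· a d (NF-tail nβ) | +-identityʳ a =
  +-cons′ (ω^⟨ a ⟩· d) (subst (λ z → Lead≼ z (ω^⟨ a ⟩· d)) (+-identityʳ a) (ω^·-Lead≼ a (NF-lead nβ)))
ω^·≡· a (ω^ (ω^ c₁ + c₂) + d) nβ rewrite ω^·≡· a d (NF-tail nβ) =
  +-cons′ (ω^⟨ a ⟩· d) (ω^·-Lead≼ a (NF-lead nβ))

-- ω^⟨ a ⟩∣ x : x is a left multiple of ω^a.
infix 4 ω^⟨_⟩∣_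
data ω^⟨_⟩∣_ (a : Tm) : Tm → Set where
  ∣𝟎  : ω^⟨ a ⟩∣ 𝟎
  ∣ω^ : ∀ {c d} → a ≼ c → ω^⟨ a ⟩∣ d → ω^⟨ a ⟩∣ ω^ c + d

∣-+ : ∀ {a} x y → ω^⟨ a ⟩∣ x → ω^⟨ a ⟩∣ y → ω^⟨ a ⟩∣ x + y
∣-+ 𝟎 y ∣x ∣y = ∣y
∣-+ (ω^ c + d) 𝟎 ∣x ∣y = ∣x
∣-+ (ω^ c + d) (ω^ e + f) (∣ω^ a≼c ∣d) ∣y with ≺-or-≽ c e
... | inj₁ c≺e rewrite +-absorb {c} {d} {e} {f} c≺e = ∣y
... | inj₂ e≼c rewrite +-cons {c} {d} {e} {f} e≼c = ∣ω^ a≼c (∣-+ d (ω^ e + f) ∣d ∣y)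

∣-+ω^⟨⟩ : ∀ a x → ω^⟨ a ⟩∣ x + ω^⟨ a ⟩
∣-+ω^⟨⟩ a 𝟎 = ∣ω^ (inj₂ refl) ∣𝟎
∣-+ω^⟨⟩ a (ω^ c + d) with ≺-or-≽ c a
... | inj₁ c≺a rewrite +-absorb {c} {d} {a} {𝟎} c≺a = ∣ω^ (inj₂ refl) ∣𝟎
... | inj₂ a≼c rewrite +-cons {c} {d} {a} {𝟎} a≼c = ∣ω^ a≼c (∣-+ω^⟨⟩ a d)

∣-ω^· : ∀ a β → ω^⟨ a ⟩∣ ω^⟨ a ⟩· β
∣-ω^· a 𝟎 = ∣𝟎
∣-ω^· a (ω^ c + d) = ∣ω^ (a≼a+b a c) (∣-ω^· a d)

∣-weaken : ∀ {a b x} → b ≼ a → ω^⟨ a ⟩∣ x → ω^⟨ b ⟩∣ x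
∣-weaken b≼a ∣𝟎 = ∣𝟎
∣-weaken b≼a (∣ω^ a≼c ∣d) = ∣ω^ (≼-trans b≼a a≼c) (∣-weaken b≼a ∣d)

∣⇒ω^⟨⟩≼ : ∀ {a c d} → ω^⟨ a ⟩∣ ω^ c + d → ω^⟨ a ⟩ ≼ ω^ c + d
∣⇒ω^⟨⟩≼ (∣ω^ (inj₁ a≺c) _) = inj₁ (≺-head a≺c)
∣⇒ω^⟨⟩≼ {d = 𝟎} (∣ω^ (inj₂ refl) _) = inj₂ refl
∣⇒ω^⟨⟩≼ {d = ω^ _ + _} (∣ω^ (inj₂ refl) _) = inj₁ (≺-tail 𝟎≺ω^)

≺⇒+ω^⟨⟩≼ : ∀ {a x y} → ω^⟨ a ⟩∣ y → x ≺ y → x + ω^⟨ a ⟩ ≼ y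
≺⇒+ω^⟨⟩≼ ∣y 𝟎≺ω^ = ∣⇒ω^⟨⟩≼ ∣y
≺⇒+ω^⟨⟩≼ {a} ∣y (≺-head {e} {f} e≺c) with ≺-or-≽ e a
... | inj₁ e≺a rewrite +-absorb {e} {f} {a} {𝟎} e≺a = ∣⇒ω^⟨⟩≼ ∣y
... | inj₂ a≼e rewrite +-cons {e} {f} {a} {𝟎} a≼e = inj₁ (≺-head e≺c)
≺⇒+ω^⟨⟩≼ {a} (∣ω^ a≼c ∣d) (≺-tail {c} {f} f≺d)
  rewrite +-cons {c} {f} {a} {𝟎} a≼c = ≼-tail (≺⇒+ω^⟨⟩≼ ∣d f≺d)

infixl 6 _⊔_
infixl 7 _⊓_
_⊔_ _⊓_ : Tm → Tm → Tm
a ⊔ b with ≺-or-≽ a b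
... | inj₁ _ = b
... | inj₂ _ = a
a ⊓ b with ≺-or-≽ a b
... | inj₁ _ = a
... | inj₂ _ = b

⊔-pres : ∀ (P : Tm → Set) {a b} → P a → P b → P (a ⊔ b)
⊔-pres P {a} {b} Pa Pb with ≺-or-≽ a b
... | inj₁ _ = Pb
... | inj₂ _ = Pa

a≼a⊔b : ∀ a b → a ≼ a ⊔ b
a≼a⊔b a b with ≺-or-≽ a b
... | inj₁ p = inj₁ p
... | inj₂ _ = inj₂ refl

b≼a⊔b : ∀ a b → b ≼ a ⊔ b
b≼a⊔b a b with ≺-or-≽ a b
... | inj₁ _ = inj₂ refl
... | inj₂ p = p

⊓-pres : ∀ (P : Tm → Set) {a b} → P a → P b → P (a ⊓ b)
⊓-pres P {a} {b} Pa Pb with ≺-or-≽ a b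
... | inj₁ _ = Pa
... | inj₂ _ = Pb

a⊓b≼a : ∀ a b → a ⊓ b ≼ a
a⊓b≼a a b with ≺-or-≽ a b
... | inj₁ _ = inj₂ refl
... | inj₂ p = p

a⊓b≼b : ∀ a b → a ⊓ b ≼ b
a⊓b≼b a b with ≺-or-≽ a b
... | inj₁ p = inj₁ p
... | inj₂ _ = inj₂ refl

⊓-glb : ∀ {a b c} → c ≼ a → c ≼ b → c ≼ a ⊓ b
⊓-glb {c = c} = ⊓-pres (c ≼_)

Seq : Set
Seq = ℕ → Tm

𝟎ˢ : Seq
𝟎ˢ _ = 𝟎

shift : Seq → Seq
shift q j = q (suc j)

AllNF : Seq → Set
AllNF q = ∀ j → NF (q j)

Normal : Seq → Set
Normal q = ∀ j → ω^⟨ q (suc j) ⟩∣ q j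

Point : Seq → Set
Point q = AllNF q × Normal q

infix 4 _≼ˢ_
_≼ˢ_ : Seq → Seq → Set
q ≼ˢ p = ∀ j → q j ≼ p j

≼ˢ-refl : ∀ {q} → q ≼ˢ q
≼ˢ-refl j = inj₂ refl

≼ˢ-trans : ∀ {q r p} → q ≼ˢ r → r ≼ˢ p → q ≼ˢ p
≼ˢ-trans q≼r r≼p j = ≼-trans (q≼r j) (r≼p j)

𝟎ˢ-point : Point 𝟎ˢ
𝟎ˢ-point = (λ _ → nf𝟎) , (λ _ → ∣𝟎)

shift-point : ∀ {q} → Point q → Point (shift q)
shift-point (nq , ∣q) = (λ j → nq (suc j)) , (λ j → ∣q (suc j))

T⁺ : ℕ → Tm → Seq → Seq
T⁺ zero    α q zero    = q 0 + ω^⟨ q 1 ⟩· α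
T⁺ zero    α q (suc j) = q (suc j)
T⁺ (suc n) α q zero    = q 0 + ω^⟨ T⁺ n α (shift q) 0 ⟩
T⁺ (suc n) α q (suc j) = T⁺ n α (shift q) j

T⁺-NF : ∀ n {α q} → NF α → AllNF q → AllNF (T⁺ n α q)
T⁺-NF zero nα nq zero = NF-+ (nq 0) (NF-ω^· (nq 1) nα)
T⁺-NF zero nα nq (suc j) = nq (suc j)
T⁺-NF (suc n) nα nq zero = NF-+ (nq 0) (nf₁ (T⁺-NF n nα (λ j → nq (suc j)) 0))
T⁺-NF (suc n) nα nq (suc j) = T⁺-NF n nα (λ j → nq (suc j)) j

T⁺-normal : ∀ n {α q} → Normal q → Normal (T⁺ n α q)
T⁺-normal zero {α} {q} ∣q zero = ∣-+ (q 0) (ω^⟨ q 1 ⟩· α) (∣q 0) (∣-ω^· (q 1) α)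
T⁺-normal zero ∣q (suc j) = ∣q (suc j)
T⁺-normal (suc n) {α} {q} ∣q zero = ∣-+ω^⟨⟩ (T⁺ n α (shift q) 0) (q 0)
T⁺-normal (suc n) ∣q (suc j) = T⁺-normal n (λ j → ∣q (suc j)) j

T⁺-point : ∀ n {α q} → NF α → Point q → Point (T⁺ n α q)
T⁺-point n nα (nq , ∣q) = T⁺-NF n nα nq , T⁺-normal n ∣q

T⁺-inflationary : ∀ n {α} q → q ≼ˢ T⁺ n α q
T⁺-inflationary zero q zero = a≼a+b (q 0) _
T⁺-inflationary zero q (suc j) = inj₂ refl
T⁺-inflationary (suc n) q zero = a≼a+b (q 0) _
T⁺-inflationary (suc n) q (suc j) = T⁺-inflationary n (shift q) j

T⁺-≻₀ : ∀ n {a b} q → q 0 ≺ T⁺ n (ω^ a + b) q 0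
T⁺-≻₀ zero q = a≺a+ω^ (q 0)
T⁺-≻₀ (suc n) q = a≺a+ω^ (q 0)

T⁺-monoˡ-≼ : ∀ n {α β} q → β ≼ α → T⁺ n β q ≼ˢ T⁺ n α q
T⁺-monoˡ-≼ zero q β≼α zero = +-monoʳ-≼ (q 0) (ω^·-monoʳ-≼ (q 1) β≼α)
T⁺-monoˡ-≼ zero q β≼α (suc j) = inj₂ refl
T⁺-monoˡ-≼ (suc n) q β≼α zero = +-monoʳ-≼ (q 0) (ω^⟨⟩-mono-≼ (T⁺-monoˡ-≼ n (shift q) β≼α 0))
T⁺-monoˡ-≼ (suc n) q β≼α (suc j) = T⁺-monoˡ-≼ n (shift q) β≼α j

T⁺-monoʳ-≼ˢ : ∀ n {α q r} → NF α → AllNF r → q ≼ˢ r → T⁺ n α q ≼ˢ T⁺ n α r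
T⁺-monoʳ-≼ˢ zero {α} {q} {r} nα nr q≼r zero =
  ≼-trans (+-monoʳ-≼ (q 0) (ω^·-monoˡ-≼ α nα (q≼r 1)))
          (+-monoˡ-≼ (ω^⟨ r 1 ⟩· α) (NF-ω^· (nr 1) nα) (q≼r 0))
T⁺-monoʳ-≼ˢ zero nα nr q≼r (suc j) = q≼r (suc j)
T⁺-monoʳ-≼ˢ (suc n) {α} {q} {r} nα nr q≼r zero =
  ≼-trans (+-monoʳ-≼ (q 0) (ω^⟨⟩-mono-≼ (T⁺-monoʳ-≼ˢ n nα (λ j → nr (suc j)) (λ j → q≼r (suc j)) 0)))
          (+-monoˡ-≼ _ (nf₁ (T⁺-NF n nα (λ j → nr (suc j)) 0)) (q≼r 0))
T⁺-monoʳ-≼ˢ (suc n) nα nr q≼r (suc j) = T⁺-monoʳ-≼ˢ n nα (λ j → nr (suc j)) (λ j → q≼r (suc j)) j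

T⁺-above : ∀ n {α} q j → n <ℕ j → T⁺ n α q j ≡ q j
T⁺-above zero q (suc j) _ = refl
T⁺-above (suc n) q (suc j) (s≤s n<j) = T⁺-above n (shift q) j n<j

T⁺-at : ∀ n {α} q → T⁺ n α q n ≡ q n + ω^⟨ q (suc n) ⟩· α
T⁺-at zero q = refl
T⁺-at (suc n) q = T⁺-at n (shift q)

T⁺-below : ∀ n {α} q j → j <ℕ n → T⁺ n α q j ≡ q j + ω^⟨ T⁺ n α q (suc j) ⟩
T⁺-below (suc n) q zero _ = refl
T⁺-below (suc n) q (suc j) (s≤s j<n) = T⁺-below n (shift q) j j<n

T⁺-+ : ∀ n {a b c d} q j → T⁺ n (ω^ c + d) (T⁺ n (ω^ a + b) q) j ≡ T⁺ n ((ω^ a + b) + (ω^ c + d)) q j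
T⁺-+ zero {a} {b} {c} {d} q zero =
  trans (+-assoc (q 0) _ _) (cong (q 0 +_) (sym (ω^·-distribʳ-+ (q 1) (ω^ a + b) (ω^ c + d))))
T⁺-+ zero q (suc j) = refl
T⁺-+ (suc n) {a} {b} q zero =
  trans (+-assoc (q 0) _ _)
        (cong (q 0 +_) (trans (+-absorb (T⁺-≻₀ n (T⁺ n (ω^ a + b) (shift q))))
                              (cong ω^⟨_⟩ (T⁺-+ n (shift q) 0))))
T⁺-+ (suc n) q (suc j) = T⁺-+ n (shift q) j

e¹≡ω^⟨⟩ : ∀ {x} → x ≢ 𝟎 → e¹ x ≡ ω^⟨ x ⟩
e¹≡ω^⟨⟩ {𝟎} x≢𝟎 = ⊥-elim (x≢𝟎 refl)
e¹≡ω^⟨⟩ {ω^ a + b} x≢𝟎 = refl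

e-𝟎 : ∀ k → e k 𝟎 ≡ 𝟎
e-𝟎 zero = refl
e-𝟎 (suc k) rewrite e-𝟎 k = refl

e-≢𝟎 : ∀ k {α} → α ≢ 𝟎 → e k α ≢ 𝟎
e-≢𝟎 zero α≢𝟎 = α≢𝟎
e-≢𝟎 (suc k) {α} α≢𝟎 rewrite e¹≡ω^⟨⟩ (e-≢𝟎 k α≢𝟎) = λ ()

NF-e : ∀ k {α} → NF α → NF (e k α)
NF-e zero nα = nα
NF-e (suc k) {α} nα = NF-e¹ (NF-e k nα)
  where
  NF-e¹ : ∀ {x} → NF x → NF (e¹ x)
  NF-e¹ nf𝟎 = nf𝟎
  NF-e¹ nx@(nf₁ _) = nf₁ nx
  NF-e¹ nx@(nf₂ _ _ _) = nf₁ nx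

T⁺₀-e : ∀ n {a b} q → NF (ω^ a + b) → AllNF q →
        q 0 + ω^⟨ q 1 ⟩· e n (ω^ a + b) ≼ T⁺ n (ω^ a + b) q 0
T⁺₀-e zero q nα nq = inj₂ refl
T⁺₀-e (suc n) {a} {b} q nα nq rewrite e¹≡ω^⟨⟩ (e-≢𝟎 n {ω^ a + b} λ ()) =
  +-monoʳ-≼ (q 0) (ω^⟨⟩-mono-≼ (≼-trans (+-monoʳ-≼ (q 1) x≼ω^·x) (T⁺₀-e n (shift q) nα (λ j → nq (suc j)))))
  where
  x = e n (ω^ a + b)
  x≼ω^·x : x ≼ ω^⟨ q 2 ⟩· x
  x≼ω^·x = subst (_≼ ω^⟨ q 2 ⟩· x) (ω^⟨𝟎⟩·-identity x) (ω^·-monoˡ-≼ x (NF-e n nα) 𝟎≼)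

T⁺-e : ∀ m n {a b} q → NF (ω^ a + b) → AllNF q → T⁺ m (e n (ω^ a + b)) q ≼ˢ T⁺ (m +ℕ n) (ω^ a + b) q
T⁺-e zero n q nα nq zero = T⁺₀-e n q nα nq
T⁺-e zero n q nα nq (suc j) = T⁺-inflationary n q (suc j)
T⁺-e (suc m) n q nα nq zero =
  +-monoʳ-≼ (q 0) (ω^⟨⟩-mono-≼ (T⁺-e m n (shift q) nα (λ j → nq (suc j)) 0))
T⁺-e (suc m) n q nα nq (suc j) = T⁺-e m n (shift q) nα (λ j → nq (suc j)) j

T : ℕ → Tm → Seq → Seq
T n 𝟎 q = q
T n (ω^ a + b) q = T⁺ n (ω^ a + b) q

T≡T⁺ : ∀ {γ} → γ ≢ 𝟎 → ∀ n q j → T n γ q j ≡ T⁺ n γ q j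
T≡T⁺ {𝟎} γ≢𝟎 n q j = ⊥-elim (γ≢𝟎 refl)
T≡T⁺ {ω^ a + b} γ≢𝟎 n q j = refl

T-inflationary : ∀ n {α} q → q ≼ˢ T n α q
T-inflationary n {𝟎} q = ≼ˢ-refl
T-inflationary n {ω^ a + b} q = T⁺-inflationary n q

T-monoˡ-≼ : ∀ n {α β} q → β ≼ α → T n β q ≼ˢ T n α q
T-monoˡ-≼ n {α} {𝟎} q _ = T-inflationary n {α} q
T-monoˡ-≼ n {𝟎} {ω^ c + d} q (inj₁ ())
T-monoˡ-≼ n {ω^ a + b} {ω^ c + d} q β≼α = T⁺-monoˡ-≼ n q β≼α

T-monoʳ-≼ˢ : ∀ n {α q r} → NF α → AllNF r → q ≼ˢ r → T n α q ≼ˢ T n α r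
T-monoʳ-≼ˢ n {𝟎} nα nr q≼r = q≼r
T-monoʳ-≼ˢ n {ω^ a + b} nα nr q≼r = T⁺-monoʳ-≼ˢ n nα nr q≼r

T-above : ∀ n α q j → n <ℕ j → T n α q j ≡ q j
T-above n 𝟎 q j _ = refl
T-above n (ω^ c + d) q j n<j = T⁺-above n q j n<j

T-point : ∀ n {α q} → NF α → Point q → Point (T n α q)
T-point n {𝟎} _ Pq = Pq
T-point n {ω^ a + b} nα Pq = T⁺-point n nα Pq

T-+ : ∀ n α β q j → T n β (T n α q) j ≡ T n (α + β) q j
T-+ n 𝟎 β q j = refl
T-+ n (ω^ a + b) 𝟎 q j = refl
T-+ n (ω^ a + b) (ω^ c + d) q j = trans (T⁺-+ n q j) (sym (T≡T⁺ (+-≢𝟎ˡ (ω^ c + d)) n q j))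

T-e : ∀ m n {α q} → NF α → AllNF q → T m (e n α) q ≼ˢ T (m +ℕ n) α q
T-e m n {𝟎} {q} _ _ rewrite e-𝟎 n = ≼ˢ-refl
T-e m n {ω^ a + b} {q} nα nq j =
  subst (_≼ T⁺ (m +ℕ n) (ω^ a + b) q j) (sym (T≡T⁺ (e-≢𝟎 n λ ()) m q j)) (T⁺-e m n q nα nq j)

⟦_⟧ : Fm → Seq → Set
⟦ ⊤ ⟧ p = Unit
⟦ φ ∧ ψ ⟧ p = ⟦ φ ⟧ p × ⟦ ψ ⟧ p
⟦ ⟨ n ^ α ⟩ φ ⟧ p = NF α × Σ Seq λ q → Point q × ⟦ φ ⟧ q × T n α q ≼ˢ p

⟦⟧-upward : ∀ φ {p p′} → ⟦ φ ⟧ p → p ≼ˢ p′ → ⟦ φ ⟧ p′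
⟦⟧-upward ⊤ _ _ = tt
⟦⟧-upward (φ ∧ ψ) (⊨φ , ⊨ψ) p≼p′ = ⟦⟧-upward φ ⊨φ p≼p′ , ⟦⟧-upward ψ ⊨ψ p≼p′
⟦⟧-upward (⟨ n ^ α ⟩ φ) (nα , q , Pq , ⊨φ , Tq≼p) p≼p′ = nα , q , Pq , ⊨φ , ≼ˢ-trans Tq≼p p≼p′

infixl 7 _⊓ˢ_
_⊓ˢ_ : Seq → Seq → Seq
(q ⊓ˢ r) j = q j ⊓ r j

⊓ˢ-point : ∀ {q r} → Point q → Point r → Point (q ⊓ˢ r)
⊓ˢ-point {q} {r} (nq , ∣q) (nr , ∣r) =
  (λ j → ⊓-pres NF (nq j) (nr j)) ,
  (λ j → ⊓-pres (ω^⟨ q (suc j) ⊓ r (suc j) ⟩∣_) (∣-weaken (a⊓b≼a (q (suc j)) (r (suc j))) (∣q j))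
                                               (∣-weaken (a⊓b≼b (q (suc j)) (r (suc j))) (∣r j)))

⟦⟧-⊓ˢ : ∀ φ {q r} → Point q → Point r → ⟦ φ ⟧ q → ⟦ φ ⟧ r → ⟦ φ ⟧ (q ⊓ˢ r)
⟦⟧-⊓ˢ ⊤ _ _ _ _ = tt
⟦⟧-⊓ˢ (φ ∧ ψ) Pq Pr (q⊨φ , q⊨ψ) (r⊨φ , r⊨ψ) = ⟦⟧-⊓ˢ φ Pq Pr q⊨φ r⊨φ , ⟦⟧-⊓ˢ ψ Pq Pr q⊨ψ r⊨ψ
⟦⟧-⊓ˢ (⟨ n ^ α ⟩ φ) {q} {r} Pq Pr (nα , q′ , Pq′ , ⊨q′ , Tq′≼q) (_ , r′ , Pr′ , ⊨r′ , Tr′≼r) =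
  nα , q′ ⊓ˢ r′ , ⊓ˢ-point Pq′ Pr′ , ⟦⟧-⊓ˢ φ Pq′ Pr′ ⊨q′ ⊨r′ ,
  λ j → ⊓-glb (≼-trans (T-monoʳ-≼ˢ n nα (proj₁ Pq′) (λ i → a⊓b≼a (q′ i) (r′ i)) j) (Tq′≼q j))
              (≼-trans (T-monoʳ-≼ˢ n nα (proj₁ Pr′) (λ i → a⊓b≼b (q′ i) (r′ i)) j) (Tr′≼r j))

Witness : ℕ → Tm → Fm → Seq → Set
Witness n γ φ p = Σ Seq λ q → Point q × ⟦ φ ⟧ q × T n γ q ≼ˢ p

⟪⟫⇒witness : ∀ n γ φ {p} → Point p → ⟦ ⟪ n ^ γ ⟫ φ ⟧ p → Witness n γ φ p
⟪⟫⇒witness n 𝟎 φ {p} Pp p⊨φ = p , Pp , p⊨φ , ≼ˢ-refl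
⟪⟫⇒witness n (ω^ a + b) φ Pp (_ , w) = w

witness⇒⟪⟫ : ∀ n γ φ {p} → NF γ → Witness n γ φ p → ⟦ ⟪ n ^ γ ⟫ φ ⟧ p
witness⇒⟪⟫ n 𝟎 φ _ (q , _ , q⊨φ , q≼p) = ⟦⟧-upward φ q⊨φ q≼p
witness⇒⟪⟫ n (ω^ a + b) φ nγ w = nγ , w

infixr 5 _∷ˢ_
_∷ˢ_ : Tm → Seq → Seq
(x ∷ˢ q) zero = x
(x ∷ˢ q) (suc j) = q j

LastWitness : ℕ → ℕ → Tm → Tm → Seq → Seq → Seq → Set
LastWitness m n α β q r p =
  Σ Seq λ w → Point w × q ≼ˢ w × T⁺ m (β + 𝟏) r ≼ˢ w × T⁺ n α w ≼ˢ p

T⁺₀-+𝟏 : ∀ β r → T⁺ 0 (β + 𝟏) r 0 ≡ (r 0 + ω^⟨ r 1 ⟩· β) + ω^⟨ r 1 ⟩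
T⁺₀-+𝟏 β r =
  trans (cong (r 0 +_) (trans (ω^·-distribʳ-+ (r 1) β 𝟏) (cong (ω^⟨ r 1 ⟩· β +_) (ω^·𝟏 (r 1)))))
        (sym (+-assoc (r 0) (ω^⟨ r 1 ⟩· β) ω^⟨ r 1 ⟩))

-- Only coordinate 0 of q has to grow, to q 0 ⊔ (X + ω^(q 1)); the second alternative stays
-- below p 0 because X ≺ p 0 and p 0 is a multiple of ω^(p 1), whose exponent dominates.
last-witness₀ : ∀ n {a b β q r p} → NF (ω^ a + b) → NF β → Point q → Point r → Point p →
                T⁺ (suc n) (ω^ a + b) q ≼ˢ p → r ≼ˢ q → T⁺ 0 (β + 𝟏) r ≼ˢ p →
                LastWitness 0 (suc n) (ω^ a + b) β q r p
last-witness₀ n {a} {b} {β} {q} {r} {p} nα nβ (nq , ∣q) (nr , _) (_ , ∣p) Tq≼p r≼q Tr≼p =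
  w , (NF-w , normal-w) , q≼w , Tr≼w , Tw≼p
  where
  X = r 0 + ω^⟨ r 1 ⟩· β
  x = q 0 ⊔ (X + ω^⟨ q 1 ⟩)
  w = x ∷ˢ shift q
  NF-w : AllNF w
  NF-w zero = ⊔-pres NF (nq 0) (NF-+ (NF-+ (nr 0) (NF-ω^· (nr 1) nβ)) (nf₁ (nq 1)))
  NF-w (suc j) = nq (suc j)
  normal-w : Normal w
  normal-w zero = ⊔-pres (ω^⟨ q 1 ⟩∣_) (∣q 0) (∣-+ω^⟨⟩ (q 1) X)
  normal-w (suc j) = ∣q (suc j)
  q≼w : q ≼ˢ w
  q≼w zero = a≼a⊔b (q 0) (X + ω^⟨ q 1 ⟩)
  q≼w (suc j) = inj₂ refl
  Tr≼w : T⁺ 0 (β + 𝟏) r ≼ˢ w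
  Tr≼w zero rewrite T⁺₀-+𝟏 β r =
    ≼-trans (+-monoʳ-≼ X (ω^⟨⟩-mono-≼ (r≼q 1))) (b≼a⊔b (q 0) (X + ω^⟨ q 1 ⟩))
  Tr≼w (suc j) = r≼q (suc j)
  t = T⁺ n (ω^ a + b) (shift q) 0
  Tw≼p : T⁺ (suc n) (ω^ a + b) w ≼ˢ p
  X+≼p : (X + ω^⟨ q 1 ⟩) + ω^⟨ t ⟩ ≼ p 0
  X+≼p rewrite +-assoc X ω^⟨ q 1 ⟩ ω^⟨ t ⟩ | +-absorb {q 1} {𝟎} {t} {𝟎} (T⁺-≻₀ n (shift q)) =
    ≺⇒+ω^⟨⟩≼ (∣-weaken (Tq≼p 1) (∣p 0)) (≺-≼-trans (a≺a+ω^ X) (subst (_≼ p 0) (T⁺₀-+𝟏 β r) (Tr≼p 0)))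
  Tw≼p zero = ⊔-pres (λ z → z + ω^⟨ t ⟩ ≼ p 0) {q 0} {X + ω^⟨ q 1 ⟩} (Tq≼p 0) X+≼p
  Tw≼p (suc j) = Tq≼p (suc j)

last-witness : ∀ m n {a b β q r p} → m <ℕ n → NF (ω^ a + b) → NF β → Point q → Point r → Point p →
               T⁺ n (ω^ a + b) q ≼ˢ p → r ≼ˢ q → T⁺ m (β + 𝟏) r ≼ˢ p →
               LastWitness m n (ω^ a + b) β q r p
last-witness zero (suc n) _ = last-witness₀ n
last-witness (suc m) (suc n) {a} {b} {β} {q} {r} {p} (s≤s m<n) nα nβ Pq@(nq , _) Pr Pp@(_ , ∣p) Tq≼p r≼q Tr≼p
  with last-witness m n m<n nα nβ (shift-point Pq) (shift-point Pr) (shift-point Pp)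
         (λ j → Tq≼p (suc j)) (λ j → r≼q (suc j)) (λ j → Tr≼p (suc j))
... | w′ , (nw′ , ∣w′) , q≼w′ , Tr≼w′ , Tw′≼p = w , (NF-w , normal-w) , q≼w , Tr≼w , Tw≼p
  where
  w = q 0 + ω^⟨ w′ 0 ⟩ ∷ˢ w′
  NF-w : AllNF w
  NF-w zero = NF-+ (nq 0) (nf₁ (nw′ 0))
  NF-w (suc j) = nw′ j
  normal-w : Normal w
  normal-w zero = ∣-+ω^⟨⟩ (w′ 0) (q 0)
  normal-w (suc j) = ∣w′ j
  q≼w : q ≼ˢ w
  q≼w zero = a≼a+b (q 0) _
  q≼w (suc j) = q≼w′ j
  Tr≼w : T⁺ (suc m) (β + 𝟏) r ≼ˢ w
  Tr≼w zero = ≼-trans (+-monoʳ-≼ (r 0) (ω^⟨⟩-mono-≼ (Tr≼w′ 0))) (+-monoˡ-≼ ω^⟨ w′ 0 ⟩ (nf₁ (nw′ 0)) (r≼q 0))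
  Tr≼w (suc j) = Tr≼w′ j
  Tw≼p : T⁺ (suc n) (ω^ a + b) w ≼ˢ p
  Tw≼p zero rewrite +-assoc (q 0) ω^⟨ w′ 0 ⟩ ω^⟨ T⁺ n (ω^ a + b) w′ 0 ⟩
                  | +-absorb {w′ 0} {𝟎} {T⁺ n (ω^ a + b) w′ 0} {𝟎} (T⁺-≻₀ n w′) =
    ≺⇒+ω^⟨⟩≼ (∣-weaken (Tw′≼p 0) (∣p 0)) (≺-≼-trans (T⁺-≻₀ (suc n) q) (Tq≼p 0))
  Tw≼p (suc j) = Tw′≼p j

Tower : ℕ → Seq → Set
Tower n G = ∀ j → j <ℕ n → G j ≡ ω^⟨ G (suc j) ⟩

tower-shift : ∀ {n G} → Tower (suc n) G → Tower n (shift G)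
tower-shift tower j j<n = tower (suc j) (s≤s j<n)

-- The exponent of the new monomial in Schmerl's axiom, once e^(n₀-n)(α₀) is read off the tower G.
schmerl : ℕ → Tm → Seq → Tm
schmerl n α G = ω^⟨ G (suc n) ⟩· (𝟏 + α)

schmerl-≢𝟎 : ∀ n α G → schmerl n α G ≢ 𝟎
schmerl-≢𝟎 n α G = ω^·-≢𝟎 (G (suc n)) (+-≢𝟎ˡ α)

NF-schmerl : ∀ n {α G} → AllNF G → NF α → NF (schmerl n α G)
NF-schmerl n nG nα = NF-ω^· (nG (suc n)) (NF-+ NF-𝟏 nα)

tower≡T⁺ω^⟨⟩ : ∀ n G → Tower (suc n) G → ∀ j → j ≤ℕ n → G j ≡ T⁺ n ω^⟨ G (suc n) ⟩ 𝟎ˢ j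
tower≡T⁺ω^⟨⟩ zero G tower zero z≤n = tower 0 (s≤s z≤n)
tower≡T⁺ω^⟨⟩ (suc n) G tower zero _ =
  trans (tower 0 (s≤s z≤n)) (cong ω^⟨_⟩ (tower≡T⁺ω^⟨⟩ n (shift G) (tower-shift tower) 0 z≤n))
tower≡T⁺ω^⟨⟩ (suc n) G tower (suc j) (s≤s j≤n) = tower≡T⁺ω^⟨⟩ n (shift G) (tower-shift tower) j j≤n

T⁺-tower : ∀ n G {c d} → Tower (suc n) G → ∀ j → j ≤ℕ n →
           T⁺ n (ω^ c + d) G j ≡ T⁺ n (schmerl n (ω^ c + d) G) 𝟎ˢ j
T⁺-tower zero G {c} {d} tower zero z≤n =
  trans (cong (_+ ω^⟨ G 1 ⟩· (ω^ c + d)) (tower 0 (s≤s z≤n)))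
        (sym (trans (ω^⟨𝟎⟩·-identity _)
             (trans (ω^·-distribʳ-+ (G 1) 𝟏 (ω^ c + d)) (cong (_+ ω^⟨ G 1 ⟩· (ω^ c + d)) (ω^·𝟏 (G 1))))))
T⁺-tower (suc n) G {c} {d} tower zero _ rewrite tower 0 (s≤s z≤n) =
  trans (+-absorb (T⁺-≻₀ n (shift G)))
        (cong ω^⟨_⟩ (T⁺-tower n (shift G) (tower-shift tower) 0 z≤n))
T⁺-tower (suc n) G tower (suc j) (s≤s j≤n) = T⁺-tower n (shift G) (tower-shift tower) j j≤n

T-tower : ∀ n α G → Tower (suc n) G → ∀ j → j ≤ℕ n → T n α G j ≡ T⁺ n (schmerl n α G) 𝟎ˢ j
T-tower n 𝟎 G tower j j≤n rewrite ω^·𝟏 (G (suc n)) = tower≡T⁺ω^⟨⟩ n G tower j j≤n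
T-tower n (ω^ c + d) G tower j j≤n = T⁺-tower n G tower j j≤n

-- On a tower, T n α G is the pointwise join of G and T⁺ n γ 𝟎ˢ: it agrees with the latter
-- up to coordinate n and with G above n.  This is the semantic content of Schmerl's axiom.
schmerl-lower : ∀ n α G → Tower (suc n) G → T⁺ n (schmerl n α G) 𝟎ˢ ≼ˢ T n α G
schmerl-lower n α G tower j with ℕ.≤-<-connex j n
... | inj₁ j≤n = inj₂ (sym (T-tower n α G tower j j≤n))
... | inj₂ n<j rewrite T⁺-above n {schmerl n α G} 𝟎ˢ j n<j = 𝟎≼

schmerl-upper : ∀ n α G {p} → Tower (suc n) G →
                T⁺ n (schmerl n α G) 𝟎ˢ ≼ˢ p → G ≼ˢ p → T n α G ≼ˢ p
schmerl-upper n α G tower T⁺≼p G≼p j with ℕ.≤-<-connex j n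
... | inj₁ j≤n rewrite T-tower n α G tower j j≤n = T⁺≼p j
... | inj₂ n<j rewrite T-above n α G j n<j = G≼p j

record TowerTo (n : ℕ) (α : Tm) (G : Seq) : Set where
  field
    top     : G n ≡ α
    tower   : Tower n G
    nonzero : α ≢ 𝟎

open TowerTo

towerTo-shift : ∀ {n α G} → TowerTo (suc n) α G → TowerTo n α (shift G)
towerTo-shift t = record { top = top t ; tower = tower-shift (tower t) ; nonzero = nonzero t }

towerTo-e : ∀ {n α G} → TowerTo n α G → ∀ j → j ≤ℕ n → G j ≡ e (n ∸ j) α
towerTo-e {zero} t zero z≤n = top t
towerTo-e {suc n} t zero _ =
  trans (tower t 0 (s≤s z≤n))
        (trans (cong ω^⟨_⟩ (towerTo-e (towerTo-shift t) 0 z≤n)) (sym (e¹≡ω^⟨⟩ (e-≢𝟎 n (nonzero t)))))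
towerTo-e {suc n} t (suc j) (s≤s j≤n) = towerTo-e (towerTo-shift t) j j≤n

towerTo-≢𝟎 : ∀ {n α G} → TowerTo n α G → ∀ j → j ≤ℕ n → G j ≢ 𝟎
towerTo-≢𝟎 {n} t j j≤n Gj≡𝟎 = e-≢𝟎 (n ∸ j) (nonzero t) (trans (sym (towerTo-e t j j≤n)) Gj≡𝟎)

towerTo-e¹ : ∀ {n α G} → TowerTo n α G → ∀ j → j <ℕ n → G j ≡ e¹ (G (suc j))
towerTo-e¹ t j j<n = trans (tower t j j<n) (sym (e¹≡ω^⟨⟩ (towerTo-≢𝟎 t (suc j) j<n)))

towerTo⇒tower : ∀ {n₀ α₀ G n} → TowerTo n₀ α₀ G → n <ℕ n₀ → Tower (suc n) G
towerTo⇒tower t n<n₀ j j≤n = tower t j (ℕ.<-≤-trans j≤n n<n₀)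

e·≡schmerl : ∀ {n₀ α₀ G n α} → TowerTo n₀ α₀ G → n <ℕ n₀ → NF α → e (n₀ ∸ n) α₀ · (𝟏 + α) ≡ schmerl n α G
e·≡schmerl {G = G} {n} {α} t n<n₀ nα =
  trans (cong (_· (𝟏 + α)) (trans (sym (towerTo-e t n (ℕ.<⇒≤ n<n₀))) (tower t n n<n₀)))
        (ω^·≡· (G (suc n)) (𝟏 + α) (NF-+ NF-𝟏 nα))

record IsLeast (ψ : Fm) (G : Seq) : Set where
  field
    point     : Point G
    satisfies : ⟦ ψ ⟧ G
    least     : ∀ {p} → ⟦ ψ ⟧ p → G ≼ˢ p

-- A least point of a chain also determines its first modality: below n it is a tower, at n not.
record LeastPoint (n : ℕ) (α : Tm) (ψ : Fm) (G : Seq) : Set where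
  field
    isLeast : IsLeast ψ G
    towerTo : TowerTo n α G
    top≢e¹  : G n ≢ e¹ (G (suc n))
  open IsLeast isLeast public

open LeastPoint

⌊_⌋ : ∀ {n α ψ} → Chain n α ψ → Seq
⌊ mono {n} {α} _ _ ⌋ = T⁺ n α 𝟎ˢ
⌊ cons {n} β c _ _ _ ⌋ = T⁺ n (𝟏 + β) ⌊ c ⌋

⊨monomial : ∀ n {α} → NF α → α ≢ 𝟎 → ⟦ ⟨ n ^ α ⟩ ⊤ ⟧ (T⁺ n α 𝟎ˢ)
⊨monomial n nα α≢𝟎 = nα , 𝟎ˢ , 𝟎ˢ-point , tt , λ j → inj₂ (T≡T⁺ α≢𝟎 n 𝟎ˢ j)

monomial-least : ∀ {n α p} → α ≢ 𝟎 → ⟦ ⟨ n ^ α ⟩ ⊤ ⟧ p → T⁺ n α 𝟎ˢ ≼ˢ p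
monomial-least {n} {α} {p} α≢𝟎 (nα , q , (nq , _) , _ , Tq≼p) j =
  ≼-trans (T⁺-monoʳ-≼ˢ n nα nq (λ _ → 𝟎≼) j) (subst (_≼ p j) (T≡T⁺ α≢𝟎 n q j) (Tq≼p j))

leastPoint-mono : ∀ {n α} → NF α → (α≢𝟎 : α ≢ 𝟎) → LeastPoint n α (⟨ n ^ α ⟩ ⊤) (T⁺ n α 𝟎ˢ)
leastPoint-mono {n} {α} nα α≢𝟎 = record
  { isLeast = record
    { point     = T⁺-point n nα 𝟎ˢ-point
    ; satisfies = ⊨monomial n nα α≢𝟎
    ; least     = monomial-least α≢𝟎
    }
  ; towerTo   = record { top = top′ ; tower = T⁺-below n 𝟎ˢ ; nonzero = α≢𝟎 }
  ; top≢e¹    = λ top≡e¹ → α≢𝟎 (trans (sym top′) (trans top≡e¹ (cong e¹ (T⁺-above n 𝟎ˢ (suc n) ℕ.≤-refl))))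
  }
  where
  top′ : T⁺ n α 𝟎ˢ n ≡ α
  top′ = trans (T⁺-at n 𝟎ˢ) (ω^⟨𝟎⟩·-identity α)

T⁺-towerTo : ∀ n β G → Tower (suc n) G → TowerTo n (schmerl n (𝟏 + β) G) (T⁺ n (𝟏 + β) G)
T⁺-towerTo n β G G-tower = record { top = top′ ; tower = tower′ ; nonzero = schmerl-≢𝟎 n (𝟏 + β) G }
  where
  γ = schmerl n (𝟏 + β) G
  low : ∀ j → j ≤ℕ n → T⁺ n (𝟏 + β) G j ≡ T⁺ n γ 𝟎ˢ j
  low j j≤n = trans (sym (T≡T⁺ (+-≢𝟎ˡ β) n G j)) (T-tower n (𝟏 + β) G G-tower j j≤n)
  top′ : T⁺ n (𝟏 + β) G n ≡ γ
  top′ = trans (low n ℕ.≤-refl) (trans (T⁺-at n 𝟎ˢ) (ω^⟨𝟎⟩·-identity γ))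
  tower′ : Tower n (T⁺ n (𝟏 + β) G)
  tower′ j j<n = trans (low j (ℕ.<⇒≤ j<n)) (trans (T⁺-below n 𝟎ˢ j j<n) (cong ω^⟨_⟩ (sym (low (suc j) j<n))))

ω^⟨⟩≺schmerl : ∀ n β G → ω^⟨ G (suc n) ⟩ ≺ schmerl n (𝟏 + β) G
ω^⟨⟩≺schmerl n β G =
  subst (_≺ schmerl n (𝟏 + β) G) (ω^·𝟏 (G (suc n)))
        (ω^·-monoʳ-≺ (G (suc n)) (≺-≼-trans (≺-tail 𝟎≺ω^) (+-monoʳ-≼ 𝟏 (a≼a+b 𝟏 β))))

leastPoint-schmerl : ∀ {n n₀ α₀ ψ G} β → LeastPoint n₀ α₀ ψ G → n <ℕ n₀ → NF β →
                     let γ = schmerl n (𝟏 + β) G in LeastPoint n γ (⟨ n ^ γ ⟩ ⊤ ∧ ψ) (T⁺ n (𝟏 + β) G)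
leastPoint-schmerl {n} {ψ = ψ} {G} β L n<n₀ nβ = record
  { isLeast = record
    { point     = T⁺-point n (NF-+ NF-𝟏 nβ) (point L)
    ; satisfies = ⊨mono , ⟦⟧-upward ψ (satisfies L) (T⁺-inflationary n G)
    ; least     = least′
    }
  ; towerTo = towerTo′
  ; top≢e¹  = top≢e¹′
  }
  where
  γ = schmerl n (𝟏 + β) G
  G-tower = towerTo⇒tower (towerTo L) n<n₀
  towerTo′ = T⁺-towerTo n β G G-tower
  T≡T⁺′ : ∀ j → T n (𝟏 + β) G j ≡ T⁺ n (𝟏 + β) G j
  T≡T⁺′ = T≡T⁺ (+-≢𝟎ˡ β) n G
  ⊨mono : ⟦ ⟨ n ^ γ ⟩ ⊤ ⟧ (T⁺ n (𝟏 + β) G)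
  ⊨mono = ⟦⟧-upward (⟨ n ^ γ ⟩ ⊤) (⊨monomial n (NF-schmerl n (proj₁ (point L)) (NF-+ NF-𝟏 nβ)) (nonzero towerTo′))
            λ j → subst (T⁺ n γ 𝟎ˢ j ≼_) (T≡T⁺′ j) (schmerl-lower n (𝟏 + β) G G-tower j)
  least′ : ∀ {p} → ⟦ ⟨ n ^ γ ⟩ ⊤ ∧ ψ ⟧ p → T⁺ n (𝟏 + β) G ≼ˢ p
  least′ {p} (p⊨mono , p⊨ψ) j = subst (_≼ p j) (T≡T⁺′ j)
    (schmerl-upper n (𝟏 + β) G G-tower (monomial-least (nonzero towerTo′) p⊨mono) (least L p⊨ψ) j)
  top≢e¹′ : T⁺ n (𝟏 + β) G n ≢ e¹ (T⁺ n (𝟏 + β) G (suc n))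
  top≢e¹′ top≡e¹ rewrite T⁺-above n {𝟏 + β} G (suc n) ℕ.≤-refl
                       | e¹≡ω^⟨⟩ (towerTo-≢𝟎 (towerTo L) (suc n) n<n₀) =
    ≺-irrefl (subst (ω^⟨ G (suc n) ⟩ ≺_) (trans (sym (top towerTo′)) top≡e¹) (ω^⟨⟩≺schmerl n β G))

leastPoint-cons : ∀ {n α n₀ α₀ ψ G} β → LeastPoint n₀ α₀ ψ G → n <ℕ n₀ → NF β →
                  α ≡ e (n₀ ∸ n) α₀ · (𝟐 + β) → LeastPoint n α (⟨ n ^ α ⟩ ⊤ ∧ ψ) (T⁺ n (𝟏 + β) G)
leastPoint-cons {n} {n₀ = n₀} {α₀} {ψ} {G} β L n<n₀ nβ α≡ =
  subst (λ α → LeastPoint n α (⟨ n ^ α ⟩ ⊤ ∧ ψ) (T⁺ n (𝟏 + β) G)) (sym α≡γ) (leastPoint-schmerl β L n<n₀ nβ)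
  where
  α≡γ = trans α≡ (trans (cong (e (n₀ ∸ n) α₀ ·_) (+-assoc 𝟏 𝟏 β)) (e·≡schmerl (towerTo L) n<n₀ (NF-+ NF-𝟏 nβ)))

⌊⌋-leastPoint : ∀ {n α ψ} (c : Chain n α ψ) → LeastPoint n α ψ ⌊ c ⌋
⌊⌋-leastPoint (mono nα α≢𝟎) = leastPoint-mono nα α≢𝟎
⌊⌋-leastPoint (cons β c n<n₀ nβ α≡) = leastPoint-cons β (⌊⌋-leastPoint c) n<n₀ nβ α≡

𝟎ˢ-least : IsLeast ⊤ 𝟎ˢ
𝟎ˢ-least = record { point = 𝟎ˢ-point ; satisfies = tt ; least = λ _ _ → 𝟎≼ }

⟪⟫-least : ∀ n {α ψ G p} → NF α → IsLeast ψ G → Point p → ⟦ ⟪ n ^ α ⟫ ψ ⟧ p → T n α G ≼ˢ p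
⟪⟫-least n {α} {ψ} nα L Pp p⊨ with ⟪⟫⇒witness n α ψ Pp p⊨
... | q , (nq , _) , q⊨ψ , Tq≼p = ≼ˢ-trans (T-monoʳ-≼ˢ n nα nq (IsLeast.least L q⊨ψ)) Tq≼p

⟪⟫-⊨ : ∀ n {α ψ G p} → NF α → IsLeast ψ G → T n α G ≼ˢ p → ⟦ ⟪ n ^ α ⟫ ψ ⟧ p
⟪⟫-⊨ n {α} {ψ} nα L TG≼p = witness⇒⟪⟫ n α ψ nα (_ , IsLeast.point L , IsLeast.satisfies L , TG≼p)

sound-mono : ∀ {n α β φ p} → NF β → β ≼ α → Point p → ⟦ ⟪ n ^ α ⟫ φ ⟧ p → ⟦ ⟪ n ^ β ⟫ φ ⟧ p
sound-mono {n} {α} {β} {φ} nβ β≼α Pp p⊨ with ⟪⟫⇒witness n α φ Pp p⊨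
... | q , Pq , q⊨φ , Tq≼p = witness⇒⟪⟫ n β φ nβ (q , Pq , q⊨φ , ≼ˢ-trans (T-monoˡ-≼ n q β≼α) Tq≼p)

sound-add₁ : ∀ {n α β φ p} → NF α → NF β → Point p →
             ⟦ ⟪ n ^ (α + β) ⟫ φ ⟧ p → ⟦ ⟪ n ^ β ⟫ ⟪ n ^ α ⟫ φ ⟧ p
sound-add₁ {n} {α} {β} {φ} {p} nα nβ Pp p⊨ with ⟪⟫⇒witness n (α + β) φ Pp p⊨
... | q , Pq , q⊨φ , Tq≼p =
  witness⇒⟪⟫ n β (⟪ n ^ α ⟫ φ) nβ
    (T n α q , T-point n nα Pq , witness⇒⟪⟫ n α φ nα (q , Pq , q⊨φ , ≼ˢ-refl) ,
     λ j → subst (_≼ p j) (sym (T-+ n α β q j)) (Tq≼p j))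

sound-add₂ : ∀ {n α β φ p} → NF α → NF β → Point p →
             ⟦ ⟪ n ^ β ⟫ ⟪ n ^ α ⟫ φ ⟧ p → ⟦ ⟪ n ^ (α + β) ⟫ φ ⟧ p
sound-add₂ {n} {α} {β} {φ} {p} nα nβ Pp p⊨ with ⟪⟫⇒witness n β (⟪ n ^ α ⟫ φ) Pp p⊨
... | r , Pr , r⊨ , Tr≼p with ⟪⟫⇒witness n α φ Pr r⊨
... | q , Pq , q⊨φ , Tq≼r =
  witness⇒⟪⟫ n (α + β) φ (NF-+ nα nβ)
    (q , Pq , q⊨φ , λ j → subst (_≼ p j) (T-+ n α β q j) (≼-trans (T-monoʳ-≼ˢ n nβ (proj₁ Pr) Tq≼r j) (Tr≼p j)))

sound-red : ∀ {m n α φ p} → NF α → Point p → ⟦ ⟪ (m +ℕ n) ^ α ⟫ φ ⟧ p → ⟦ ⟪ m ^ e n α ⟫ φ ⟧ p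
sound-red {m} {n} {α} {φ} nα Pp p⊨ with ⟪⟫⇒witness (m +ℕ n) α φ Pp p⊨
... | q , Pq@(nq , _) , q⊨φ , Tq≼p =
  witness⇒⟪⟫ m (e n α) φ (NF-e n nα) (q , Pq , q⊨φ , ≼ˢ-trans (T-e m n nα nq) Tq≼p)

sound-sch₁ : ∀ {n n₀ α α₀ ψ p} → n <ℕ n₀ → Chain n₀ α₀ ψ → NF α → Point p →
             ⟦ ⟪ n ^ α ⟫ ψ ⟧ p → ⟦ ⟪ n ^ (e (n₀ ∸ n) α₀ · (𝟏 + α)) ⟫ ⊤ ∧ ψ ⟧ p
sound-sch₁ {n} {α = α} {ψ = ψ} {p} n<n₀ c nα Pp p⊨ =
  subst (λ γ → ⟦ ⟪ n ^ γ ⟫ ⊤ ⟧ p) (sym (e·≡schmerl (towerTo L) n<n₀ nα))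
    (⟪⟫-⊨ n (NF-schmerl n (proj₁ (point L)) nα) 𝟎ˢ-least λ j →
      subst (_≼ p j) (sym (T≡T⁺ (schmerl-≢𝟎 n α G) n 𝟎ˢ j))
        (≼-trans (schmerl-lower n α G (towerTo⇒tower (towerTo L) n<n₀) j) (TG≼p j))) ,
  ⟦⟧-upward ψ (satisfies L) (≼ˢ-trans (T-inflationary n {α} G) TG≼p)
  where
  L = ⌊⌋-leastPoint c
  G = ⌊ c ⌋
  TG≼p : T n α G ≼ˢ p
  TG≼p = ⟪⟫-least n nα (isLeast L) Pp p⊨

sound-sch₂ : ∀ {n n₀ α α₀ ψ p} → n <ℕ n₀ → Chain n₀ α₀ ψ → NF α → Point p →
             ⟦ ⟪ n ^ (e (n₀ ∸ n) α₀ · (𝟏 + α)) ⟫ ⊤ ∧ ψ ⟧ p → ⟦ ⟪ n ^ α ⟫ ψ ⟧ p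
sound-sch₂ {n} {α = α} {ψ = ψ} {p} n<n₀ c nα Pp (p⊨mono , p⊨ψ) =
  ⟪⟫-⊨ n nα (isLeast L) (schmerl-upper n α G (towerTo⇒tower (towerTo L) n<n₀) T⁺≼p (least L p⊨ψ))
  where
  L = ⌊⌋-leastPoint c
  G = ⌊ c ⌋
  nγ : NF (schmerl n α G)
  nγ = NF-schmerl n (proj₁ (point L)) nα
  T⁺≼p : T⁺ n (schmerl n α G) 𝟎ˢ ≼ˢ p
  T⁺≼p j = subst (_≼ p j) (T≡T⁺ (schmerl-≢𝟎 n α G) n 𝟎ˢ j)
    (⟪⟫-least n nγ 𝟎ˢ-least Pp (subst (λ γ → ⟦ ⟪ n ^ γ ⟫ ⊤ ⟧ p) (e·≡schmerl (towerTo L) n<n₀ nα) p⊨mono) j)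

-- ψ holds at q (by the premise) and at r, hence at q ⊓ˢ r, which lies below q as last-witness requires.
sound-last : ∀ {n m α β φ ψ p} → NF α → NF β → m <ℕ n → (∀ {q} → Point q → ⟦ φ ⟧ q → ⟦ ψ ⟧ q) → Point p →
             ⟦ ⟪ n ^ α ⟫ φ ∧ ⟪ m ^ (β + 𝟏) ⟫ ψ ⟧ p → ⟦ ⟪ n ^ α ⟫ (φ ∧ ⟪ m ^ (β + 𝟏) ⟫ ψ) ⟧ p
sound-last {α = 𝟎} _ _ _ _ _ p⊨ = p⊨
sound-last {n} {m} {ω^ a + b} {β} {φ} {ψ} {p} nα nβ m<n φ⇒ψ Pp ((_ , q , Pq , q⊨φ , Tq≼p) , p⊨◇ψ)
  with ⟪⟫⇒witness m (β + 𝟏) ψ Pp p⊨◇ψ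
... | r , Pr , r⊨ψ , Tr≼p
  with last-witness m n m<n nα nβ Pq (⊓ˢ-point Pq Pr) Pp Tq≼p (λ j → a⊓b≼a (q j) (r j)) T⁺q⊓r≼p
  where
  T⁺q⊓r≼p : T⁺ m (β + 𝟏) (q ⊓ˢ r) ≼ˢ p
  T⁺q⊓r≼p j = ≼-trans (T⁺-monoʳ-≼ˢ m (NF-+ nβ NF-𝟏) (proj₁ Pr) (λ i → a⊓b≼b (q i) (r i)) j)
                      (subst (_≼ p j) (T≡T⁺ (+-≢𝟎ʳ β) m r j) (Tr≼p j))
... | w , Pw , q≼w , T⁺q⊓r≼w , Tw≼p =
  nα , w , Pw , (⟦⟧-upward φ q⊨φ q≼w , witness⇒⟪⟫ m (β + 𝟏) ψ (NF-+ nβ NF-𝟏) (q ⊓ˢ r , ⊓ˢ-point Pq Pr ,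
    ⟦⟧-⊓ˢ ψ Pq Pr (φ⇒ψ Pq q⊨φ) r⊨ψ , λ j → subst (_≼ w j) (sym (T≡T⁺ (+-≢𝟎ʳ β) m (q ⊓ˢ r) j)) (T⁺q⊓r≼w j))) ,
  Tw≼p

sound : ∀ {φ ψ} → φ ⊢ ψ → ∀ {p} → Point p → ⟦ φ ⟧ p → ⟦ ψ ⟧ p
sound (ax-id _) _ p⊨ = p⊨
sound (ax-⊤ _) _ _ = tt
sound (ax-∧ˡ _ _) _ (p⊨φ , _) = p⊨φ
sound (ax-∧ʳ _ _) _ (_ , p⊨ψ) = p⊨ψ
sound (ax-mono _ nβ β≤α _) = sound-mono nβ (≤⇒≼ β≤α)
sound (ax-add₁ nα nβ _) = sound-add₁ nα nβ
sound (ax-add₂ nα nβ _) = sound-add₂ nα nβ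
sound (ax-red nα _) = sound-red nα
sound (ax-sch₁ n<n₀ c nα) = sound-sch₁ n<n₀ c nα
sound (ax-sch₂ n<n₀ c nα) = sound-sch₂ n<n₀ c nα
sound (r-∧ d₁ d₂) Pp p⊨ = sound d₁ Pp p⊨ , sound d₂ Pp p⊨
sound (r-cut d₁ d₂) Pp p⊨ = sound d₂ Pp (sound d₁ Pp p⊨)
sound (r-nec {n} {α} {φ} {ψ} nα d) Pp p⊨ with ⟪⟫⇒witness n α φ Pp p⊨
... | q , Pq , q⊨φ , Tq≼p = witness⇒⟪⟫ n α ψ nα (q , Pq , sound d Pq q⊨φ , Tq≼p)
sound (r-last nα nβ m<n d) = sound-last nα nβ m<n (sound d)

tower-unique : ∀ n {A B} → Tower (suc n) A → Tower (suc n) B → A (suc n) ≡ B (suc n) → ∀ j → j ≤ℕ n → A j ≡ B j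
tower-unique zero tA tB A≡B zero z≤n =
  trans (tA 0 (s≤s z≤n)) (trans (cong ω^⟨_⟩ A≡B) (sym (tB 0 (s≤s z≤n))))
tower-unique (suc n) tA tB A≡B zero _ =
  trans (tA 0 (s≤s z≤n))
        (trans (cong ω^⟨_⟩ (tower-unique n (tower-shift tA) (tower-shift tB) A≡B 0 z≤n)) (sym (tB 0 (s≤s z≤n))))
tower-unique (suc n) tA tB A≡B (suc j) (s≤s j≤n) = tower-unique n (tower-shift tA) (tower-shift tB) A≡B j j≤n

leastPoint-index-unique : ∀ {n α ψ n′ α′ ψ′ G G′} → LeastPoint n α ψ G → LeastPoint n′ α′ ψ′ G′ →
                          G ≗ G′ → n ≡ n′
leastPoint-index-unique {n} {n′ = n′} L L′ G≗G′ with ℕ.<-cmp n n′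
... | tri< n<n′ _ _ =
  ⊥-elim (top≢e¹ L (trans (G≗G′ n) (trans (towerTo-e¹ (towerTo L′) n n<n′) (cong e¹ (sym (G≗G′ (suc n)))))))
... | tri≈ _ n≡n′ _ = n≡n′
... | tri> _ _ n′<n =
  ⊥-elim (top≢e¹ L′ (trans (sym (G≗G′ n′)) (trans (towerTo-e¹ (towerTo L) n′ n′<n) (cong e¹ (G≗G′ (suc n′))))))

leastPoint-exponent-unique : ∀ {n α ψ α′ ψ′ G G′} → LeastPoint n α ψ G → LeastPoint n α′ ψ′ G′ →
                             G ≗ G′ → α ≡ α′
leastPoint-exponent-unique {n} L L′ G≗G′ = trans (sym (top (towerTo L))) (trans (G≗G′ n) (top (towerTo L′)))

mutual
  ⌊⌋-injective : ∀ {n α ψ n′ α′ ψ′} (c : Chain n α ψ) (c′ : Chain n′ α′ ψ′) → ⌊ c ⌋ ≗ ⌊ c′ ⌋ → ψ ≡ ψ′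
  ⌊⌋-injective c c′ G≗G′ with leastPoint-index-unique (⌊⌋-leastPoint c) (⌊⌋-leastPoint c′) G≗G′
  ... | refl = ⌊⌋-injective-at c c′ G≗G′ (leastPoint-exponent-unique (⌊⌋-leastPoint c) (⌊⌋-leastPoint c′) G≗G′)

  ⌊⌋-injective-at : ∀ {n α ψ α′ ψ′} (c : Chain n α ψ) (c′ : Chain n α′ ψ′) →
                    ⌊ c ⌋ ≗ ⌊ c′ ⌋ → α ≡ α′ → ψ ≡ ψ′
  ⌊⌋-injective-at {n} (mono _ _) (mono _ _) _ α≡α′ = cong (λ z → ⟨ n ^ z ⟩ ⊤) α≡α′
  ⌊⌋-injective-at {n} (mono _ _) (cons _ c′ n<n₀′ _ _) G≗G′ _ =
    ⊥-elim (towerTo-≢𝟎 (towerTo (⌊⌋-leastPoint c′)) (suc n) n<n₀′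
      (trans (sym (T⁺-above n ⌊ c′ ⌋ (suc n) ℕ.≤-refl)) (trans (sym (G≗G′ (suc n))) (T⁺-above n 𝟎ˢ (suc n) ℕ.≤-refl))))
  ⌊⌋-injective-at {n} (cons _ c n<n₀ _ _) (mono _ _) G≗G′ _ =
    ⊥-elim (towerTo-≢𝟎 (towerTo (⌊⌋-leastPoint c)) (suc n) n<n₀
      (trans (sym (T⁺-above n ⌊ c ⌋ (suc n) ℕ.≤-refl)) (trans (G≗G′ (suc n)) (T⁺-above n 𝟎ˢ (suc n) ℕ.≤-refl))))
  ⌊⌋-injective-at {n} (cons β c n<n₀ _ _) (cons β′ c′ n<n₀′ _ _) G≗G′ α≡α′ =
    cong₂ _∧_ (cong (λ z → ⟨ n ^ z ⟩ ⊤) α≡α′) (⌊⌋-injective c c′ tails≗)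
    where
    above : ∀ j → n <ℕ j → ⌊ c ⌋ j ≡ ⌊ c′ ⌋ j
    above j n<j = trans (sym (T⁺-above n ⌊ c ⌋ j n<j)) (trans (G≗G′ j) (T⁺-above n ⌊ c′ ⌋ j n<j))
    tails≗ : ⌊ c ⌋ ≗ ⌊ c′ ⌋
    tails≗ j with ℕ.≤-<-connex j n
    ... | inj₁ j≤n = tower-unique n (towerTo⇒tower (towerTo (⌊⌋-leastPoint c)) n<n₀)
                       (towerTo⇒tower (towerTo (⌊⌋-leastPoint c′)) n<n₀′) (above (suc n) ℕ.≤-refl) j j≤n
    ... | inj₂ n<j = above j n<j

chain-unsatisfied-at-𝟎ˢ : ∀ {n α ψ} → Chain n α ψ → ⟦ ψ ⟧ 𝟎ˢ → ⊥
chain-unsatisfied-at-𝟎ˢ {n} c 𝟎ˢ⊨ψ =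
  nonzero (towerTo L) (trans (sym (top (towerTo L))) (≼𝟎⇒≡𝟎 (least L 𝟎ˢ⊨ψ n)))
  where L = ⌊⌋-leastPoint c

≣⇒⌊⌋≗ : ∀ {n α ψ n′ α′ ψ′} (c : Chain n α ψ) (c′ : Chain n′ α′ ψ′) → ψ ≣ ψ′ → ⌊ c ⌋ ≗ ⌊ c′ ⌋
≣⇒⌊⌋≗ c c′ (ψ⊢ψ′ , ψ′⊢ψ) j =
  ≼-antisym (least L (sound ψ′⊢ψ (point L′) (satisfies L′)) j) (least L′ (sound ψ⊢ψ′ (point L) (satisfies L)) j)
  where
  L = ⌊⌋-leastPoint c
  L′ = ⌊⌋-leastPoint c′

theorem6p18 : (ψ₁ ψ₂ : Fm) → MNF ψ₁ → MNF ψ₂ → ψ₁ ≣ ψ₂ → ψ₁ ≡ ψ₂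
theorem6p18 _ _ (inj₁ refl) (inj₁ refl) _ = refl
theorem6p18 _ _ (inj₁ refl) (inj₂ (_ , _ , c)) (⊤⊢ψ , _) = ⊥-elim (chain-unsatisfied-at-𝟎ˢ c (sound ⊤⊢ψ 𝟎ˢ-point tt))
theorem6p18 _ _ (inj₂ (_ , _ , c)) (inj₁ refl) (_ , ⊤⊢ψ) = ⊥-elim (chain-unsatisfied-at-𝟎ˢ c (sound ⊤⊢ψ 𝟎ˢ-point tt))
theorem6p18 _ _ (inj₂ (_ , _ , c)) (inj₂ (_ , _ , c′)) ψ₁≣ψ₂ = ⌊⌋-injective c c′ (≣⇒⌊⌋≗ c c′ ψ₁≣ψ₂)
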